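{- Let $n>3$ be an odd integer and $k=1$, and let $$g^*_{n,k}(x):=(-k(n-1)+2n)+\sum_{j=1}^{(n-1)/2-1}\Big[k\binom{n-1}{2j+1}-k\binom{n-1}{2j-1}+2\binom{n}{2j}\Big]x^j+(-k(n-1)+2n)x^{(n-1)/2}\in\mathbb{Z}[x],$$ $$C_{n,k}(x):=g^*_{n,k}(x)-(n+1)x^{(n-1)/2}.$$ Then, with $N=(n-1)/2$, $C_{n,1}(x)$ viewed as an element of $\mathbb{Z}[x]/(x^N-1)$ is a coterm polynomial.
   Context: For a commutative ring $R$ with identity and $N\ge1$, a polynomial $a_0+a_1x+\cdots+a_{N-1}x^{N-1}\in R[x]/(x^N-1)$ with $a_i\in R$ is a coterm polynomial if $a_i=a_{N-i}$ for all $1\le i\le\lfloor N/2\rfloor$. Binomial coefficients $\binom{a}{b}$ are $0$ when $b>a$. -}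

module Defs where

open import Data.Nat as ℕ using (ℕ; zero; suc; _∸_; _≟_)
open import Data.Nat.Combinatorics using (_C_)
open import Data.Integer as ℤ using (ℤ; +_; _+_; _-_; _*_; -_)
open import Data.List using (List; []; _∷_; map; replicate; _++_)
open import Data.List.Base using (upTo)
open import Data.Bool using (if_then_else_)
open import Relation.Nullary.Decidable using (⌊_⌋)
open import Relation.Binary.PropositionalEquality using (_≡_)

-- Polynomials in ℤ[x] as coefficient lists, lowest degree first
-- (entry at position e is the coefficient of x^e).
Poly : Set
Poly = List ℤ

_+ₚ_ : Poly → Poly → Poly
[] +ₚ q = q
(a ∷ p) +ₚ [] = a ∷ p
(a ∷ p) +ₚ (b ∷ q) = (a + b) ∷ (p +ₚ q)

-ₚ_ : Poly → Poly
-ₚ p = map -_ p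

_-ₚ_ : Poly → Poly → Poly
p -ₚ q = p +ₚ (-ₚ q)

monomial : ℤ → ℕ → Poly
monomial c d = replicate d (+ 0) ++ (c ∷ [])

-- Image of a polynomial in ℤ[x]/(x^N - 1): the coefficient a_i (0 ≤ i < N) of the
-- reduced representative a_0 + a_1 x + ... + a_{N-1} x^{N-1} is the sum of the
-- coefficients c_e with e ≡ i (mod N).  'pos' runs through e mod N (wrapping at N).
reduceFrom : (N : ℕ) → ℕ → Poly → ℕ → ℤ
reduceFrom N pos [] i = + 0
reduceFrom N pos (c ∷ p) i =
  (if ⌊ pos ≟ i ⌋ then c else + 0)
  + reduceFrom N (if ⌊ suc pos ≟ N ⌋ then 0 else suc pos) p i

reduceMod : (N : ℕ) → Poly → ℕ → ℤ
reduceMod N p = reduceFrom N 0 p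

IsCoterm : (N : ℕ) → (ℕ → ℤ) → Set
IsCoterm N a = ∀ i → 1 ℕ.≤ i → i ℕ.≤ N ℕ./ 2 → a i ≡ a (N ∸ i)

gstarCoeff : ℕ → ℕ → ℕ → ℤ
gstarCoeff n k e =
  if ⌊ e ≟ 0 ⌋ then end
  else if ⌊ e ≟ (n ∸ 1) ℕ./ 2 ⌋ then end
  else (+ k * + ((n ∸ 1) C (2 ℕ.* e ℕ.+ 1))
        - + k * + ((n ∸ 1) C (2 ℕ.* e ∸ 1))
        + + 2 * + (n C (2 ℕ.* e)))
  where
  end : ℤ
  end = - (+ k * + (n ∸ 1)) + + 2 * + n

gstar : ℕ → ℕ → Poly
gstar n k = map (gstarCoeff n k) (upTo (suc ((n ∸ 1) ℕ./ 2)))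

Cpoly : ℕ → ℕ → Poly
Cpoly n k = gstar n k -ₚ monomial (+ (suc n)) ((n ∸ 1) ℕ./ 2)

-- Write n = 2N + 1.  For 1 ≤ i ≤ ⌊N/2⌋ both i and N − i lie strictly between 0 and N, and
-- C_{n,1} has degree N, so the coefficients a_i and a_{N−i} of its reduction modulo x^N − 1 are
-- middle coefficients of g*_{n,1}; the end terms and the subtracted (n+1)x^N only affect a_0.
-- By Pascal's rule the middle coefficient of x^e equals
--   C(2N, 2e+1) + C(2N, 2e−1) + 2 C(2N, 2e),
-- which the symmetry C(2N, k) = C(2N, 2N − k) leaves unchanged under e ↦ N − e.
module Submission where

open import Defs
open import Data.Nat using (ℕ; _<_; _∸_; _/_; _%_)
open import Relation.Binary.PropositionalEquality using (_≡_)

open import Data.Nat as ℕ using (zero; suc; _+_; _*_; _≤_; _≟_)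
open import Data.Nat.Properties
  using (suc-injective; +-comm; +-suc; +-identityʳ; *-comm; *-suc; *-identityˡ; *-distribˡ-+;
         +-cancelˡ-≤; +-mono-≤; +-monoʳ-≤; ≤-reflexive; ≤-trans; <-irrefl; <⇒≤; <⇒≱; ≤∧≢⇒<;
         m≤m+n; m<m+n; n<1+n; m<n⇒m<1+n; m+1+n≰m; m+1+n≢m; m+[n∸m]≡n; m+n∸m≡n; m<n⇒0<n∸m;
         ∸-monoʳ-<; module ≤-Reasoning)
open import Data.Nat.DivMod using (m≡m%n+[m/n]*n; m*n/n≡m; m/n*n≤m)
open import Data.Nat.Combinatorics using (_C_; nCk≡nC[n∸k]; nCk+nC[k+1]≡[n+1]C[k+1])
open import Data.Nat.Tactic.RingSolver as ℕ-Solver using ()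
open import Data.Integer as ℤ using (ℤ; +_; -_)
import Data.Integer.Properties as ℤ
open import Data.Integer.Tactic.RingSolver as ℤ-Solver using ()
open import Data.List using ([]; _∷_; map; replicate; length; applyUpTo)
open import Data.List.Properties using (length-map; length-++; length-replicate; length-applyUpTo)
open import Data.Empty using (⊥-elim)
open import Relation.Nullary using (yes; no)
open import Relation.Binary.PropositionalEquality
  using (refl; sym; trans; cong; cong₂; subst; module ≡-Reasoning)

coeff : Poly → ℕ → ℤ
coeff []      e       = + 0
coeff (c ∷ p) zero    = c
coeff (c ∷ p) (suc e) = coeff p e

private
  +-suc-≤ : ∀ {pos l m} → pos + suc l ≤ m → suc pos + l ≤ m
  +-suc-≤ {pos} {l} {m} = subst (_≤ m) (+-suc pos l)

reduceFrom-before : ∀ N pos p i → pos + length p ≤ i → i < N → reduceFrom N pos p i ≡ + 0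
reduceFrom-before N pos []      i _ _ = refl
reduceFrom-before N pos (c ∷ p) i h i<N with pos ≟ i | suc pos ≟ N
... | yes refl | _        = ⊥-elim (m+1+n≰m pos h)
... | no _     | yes refl = ⊥-elim (<⇒≱ i<N (≤-trans (m≤m+n (suc pos) (length p)) (+-suc-≤ h)))
... | no _     | no _     = cong (ℤ._+_ (+ 0)) (reduceFrom-before N (suc pos) p i (+-suc-≤ h) i<N)

reduceFrom-after : ∀ N pos p i → i < pos → pos < N → pos + length p ≤ N + i →
                   reduceFrom N pos p i ≡ + 0
reduceFrom-after N pos []      i _ _ _ = refl
reduceFrom-after N pos (c ∷ p) i i<pos pos<N h with pos ≟ i | suc pos ≟ N
... | yes refl | _        = ⊥-elim (<-irrefl refl i<pos)
... | no _     | yes refl = cong (ℤ._+_ (+ 0))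
  (reduceFrom-before N 0 p i (+-cancelˡ-≤ (suc pos) _ _ (+-suc-≤ h)) (m<n⇒m<1+n i<pos))
... | no _     | no pos+1≢N = cong (ℤ._+_ (+ 0))
  (reduceFrom-after N (suc pos) p i (m<n⇒m<1+n i<pos) (≤∧≢⇒< pos<N pos+1≢N) (+-suc-≤ h))

reduceFrom-coeff : ∀ N pos p i d → pos + d ≡ i → i < N → pos + length p ≤ N + i →
                   reduceFrom N pos p i ≡ coeff p d
reduceFrom-coeff N pos []      i d _ _ _ = refl
reduceFrom-coeff N pos (c ∷ p) i zero pos+0≡i i<N h with pos ≟ i | suc pos ≟ N
... | no pos≢i | _        = ⊥-elim (pos≢i (trans (sym (+-identityʳ pos)) pos+0≡i))
... | yes refl | yes refl = trans
  (cong (ℤ._+_ c) (reduceFrom-before N 0 p i (+-cancelˡ-≤ (suc pos) _ _ (+-suc-≤ h)) i<N))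
  (ℤ.+-identityʳ c)
... | yes refl | no pos+1≢N = trans
  (cong (ℤ._+_ c) (reduceFrom-after N (suc pos) p i (n<1+n pos) (≤∧≢⇒< i<N pos+1≢N) (+-suc-≤ h)))
  (ℤ.+-identityʳ c)
reduceFrom-coeff N pos (c ∷ p) i (suc d) pos+d+1≡i i<N h with pos ≟ i | suc pos ≟ N
... | yes refl | _        = ⊥-elim (m+1+n≢m pos pos+d+1≡i)
... | no _     | yes refl = ⊥-elim (<⇒≱ i<N
  (≤-trans (m≤m+n (suc pos) d) (subst (_≤ i) (+-suc pos d) (≤-reflexive pos+d+1≡i))))
... | no _     | no _     = trans (ℤ.+-identityˡ _)
  (reduceFrom-coeff N (suc pos) p i d (trans (sym (+-suc pos d)) pos+d+1≡i) i<N (+-suc-≤ h))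

-- The exponents contributing to a_i are i, N + i, 2N + i, …; the degree bound leaves only i.
reduceMod-coeff : ∀ N p i → i < N → length p ≤ N + i → reduceMod N p i ≡ coeff p i
reduceMod-coeff N p i i<N h = reduceFrom-coeff N 0 p i i refl i<N h

coeff-+ₚ : ∀ p q e → coeff (p +ₚ q) e ≡ coeff p e ℤ.+ coeff q e
coeff-+ₚ []      q       e       = sym (ℤ.+-identityˡ _)
coeff-+ₚ (a ∷ p) []      e       = sym (ℤ.+-identityʳ _)
coeff-+ₚ (a ∷ p) (b ∷ q) zero    = refl
coeff-+ₚ (a ∷ p) (b ∷ q) (suc e) = coeff-+ₚ p q e

coeff--ₚ : ∀ p e → coeff (-ₚ p) e ≡ - coeff p e
coeff--ₚ []      e       = refl
coeff--ₚ (a ∷ p) zero    = refl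
coeff--ₚ (a ∷ p) (suc e) = coeff--ₚ p e

coeff-map-applyUpTo : ∀ (g : ℕ → ℤ) f m e → e < m → coeff (map g (applyUpTo f m)) e ≡ g (f e)
coeff-map-applyUpTo g f (suc m) zero    _           = refl
coeff-map-applyUpTo g f (suc m) (suc e) (ℕ.s≤s e<m) =
  coeff-map-applyUpTo g (λ x → f (suc x)) m e e<m

coeff-monomial-< : ∀ c d e → e < d → coeff (monomial c d) e ≡ + 0
coeff-monomial-< c (suc d) zero    _           = refl
coeff-monomial-< c (suc d) (suc e) (ℕ.s≤s e<d) = coeff-monomial-< c d e e<d

length-+ₚ-≤ : ∀ {m} p q → length p ≤ m → length q ≤ m → length (p +ₚ q) ≤ m
length-+ₚ-≤ []      q       _           h = h
length-+ₚ-≤ (a ∷ p) []      h           _ = h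
length-+ₚ-≤ (a ∷ p) (b ∷ q) (ℕ.s≤s hp) (ℕ.s≤s hq) = ℕ.s≤s (length-+ₚ-≤ p q hp hq)

length-gstar : ∀ n k → length (gstar n k) ≡ suc ((n ∸ 1) / 2)
length-gstar n k =
  trans (length-map (gstarCoeff n k) (applyUpTo (λ x → x) N)) (length-applyUpTo (λ x → x) N)
  where
  N : ℕ
  N = suc ((n ∸ 1) / 2)

length-monomial : ∀ c d → length (monomial c d) ≡ suc d
length-monomial c d =
  trans (length-++ (replicate d (+ 0))) (trans (cong (_+ 1) (length-replicate d)) (+-comm d 1))

length-Cpoly : ∀ n k → length (Cpoly n k) ≤ suc ((n ∸ 1) / 2)
length-Cpoly n k = length-+ₚ-≤ (gstar n k) (-ₚ monomial (+ suc n) N)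
  (≤-reflexive (length-gstar n k))
  (≤-reflexive (trans (length-map -_ (monomial (+ suc n) N)) (length-monomial (+ suc n) N)))
  where
  N : ℕ
  N = (n ∸ 1) / 2

middleCoeff : ℕ → ℕ → ℕ
middleCoeff K e = K C (2 * e + 1) + K C (2 * e ∸ 1) + 2 * (K C (2 * e))

private
  cancel-pascal : ∀ (x y z : ℤ) →
    + 1 ℤ.* x ℤ.- + 1 ℤ.* y ℤ.+ + 2 ℤ.* (y ℤ.+ z) ≡ x ℤ.+ y ℤ.+ + 2 ℤ.* z
  cancel-pascal = ℤ-Solver.solve-∀

gstarCoeff-middle : ∀ K e → 0 < e → e < K / 2 → gstarCoeff (suc K) 1 e ≡ + middleCoeff K e
gstarCoeff-middle K (suc a) _ e<N with suc a ≟ K / 2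
... | yes e≡N = ⊥-elim (<-irrefl e≡N e<N)
... | no _    = begin
    + 1 ℤ.* + x ℤ.- + 1 ℤ.* + y ℤ.+ + 2 ℤ.* + (suc K C (2 * e))
  ≡⟨ cong (λ m → + 1 ℤ.* + x ℤ.- + 1 ℤ.* + y ℤ.+ + 2 ℤ.* + m) pascal ⟩
    + 1 ℤ.* + x ℤ.- + 1 ℤ.* + y ℤ.+ + 2 ℤ.* (+ y ℤ.+ + z)
  ≡⟨ cancel-pascal (+ x) (+ y) (+ z) ⟩
    + x ℤ.+ + y ℤ.+ + 2 ℤ.* + z
  ≡⟨ cong (ℤ._+_ (+ (x + y))) (sym (ℤ.pos-* 2 z)) ⟩
    + middleCoeff K e ∎
  where
  open ≡-Reasoning
  e x y z : ℕ
  e = suc a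
  x = K C (2 * e + 1)
  y = K C (2 * e ∸ 1)
  z = K C (2 * e)
  pascal : suc K C (2 * e) ≡ y + z
  pascal = sym (nCk+nC[k+1]≡[n+1]C[k+1] K (2 * e ∸ 1))

C-symmetric : ∀ K k l → k + l ≡ K → K C k ≡ K C l
C-symmetric _ k l refl = trans (nCk≡nC[n∸k] (m≤m+n k l)) (cong ((k + l) C_) (m+n∸m≡n k l))

odd-split : ∀ i j → 0 < j → (2 * i + 1) + (2 * j ∸ 1) ≡ 2 * (i + j)
odd-split i (suc b) _ = trans (cong (λ m → 2 * i + 1 + (m ∸ 1)) (*-suc 2 b)) (identity i b)
  where
  identity : ∀ i b → 2 * i + 1 + suc (2 * b) ≡ 2 * (i + suc b)
  identity = ℕ-Solver.solve-∀

middleCoeff-symmetric : ∀ K i j → 2 * (i + j) ≡ K → 0 < i → 0 < j →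
                        middleCoeff K i ≡ middleCoeff K j
middleCoeff-symmetric K i j 2[i+j]≡K 0<i 0<j = begin
    K C (2 * i + 1) + K C (2 * i ∸ 1) + 2 * (K C (2 * i))
  ≡⟨ cong₂ (λ u v → u + v + 2 * (K C (2 * i)))
       (C-symmetric K (2 * i + 1) (2 * j ∸ 1) (trans (odd-split i j 0<j) 2[i+j]≡K))
       (C-symmetric K (2 * i ∸ 1) (2 * j + 1)
         (trans (+-comm (2 * i ∸ 1) (2 * j + 1))
           (trans (odd-split j i 0<i) (trans (cong (2 *_) (+-comm j i)) 2[i+j]≡K)))) ⟩
    K C (2 * j ∸ 1) + K C (2 * j + 1) + 2 * (K C (2 * i))
  ≡⟨ cong₂ (λ u v → u + 2 * v) (+-comm (K C (2 * j ∸ 1)) (K C (2 * j + 1)))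
       (C-symmetric K (2 * i) (2 * j) (trans (sym (*-distribˡ-+ 2 i j)) 2[i+j]≡K)) ⟩
    K C (2 * j + 1) + K C (2 * j ∸ 1) + 2 * (K C (2 * j)) ∎
  where open ≡-Reasoning

coeff-Cpoly-middle : ∀ K e → 0 < e → e < K / 2 → coeff (Cpoly (suc K) 1) e ≡ + middleCoeff K e
coeff-Cpoly-middle K e 0<e e<N = begin
    coeff (Cpoly (suc K) 1) e
  ≡⟨ coeff-+ₚ (gstar (suc K) 1) (-ₚ monomial c N) e ⟩
    coeff (gstar (suc K) 1) e ℤ.+ coeff (-ₚ monomial c N) e
  ≡⟨ cong₂ ℤ._+_ (coeff-map-applyUpTo (gstarCoeff (suc K) 1) (λ x → x) (suc N) e (m<n⇒m<1+n e<N))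
                 (trans (coeff--ₚ (monomial c N) e) (cong -_ (coeff-monomial-< c N e e<N))) ⟩
    gstarCoeff (suc K) 1 e ℤ.+ + 0
  ≡⟨ ℤ.+-identityʳ _ ⟩
    gstarCoeff (suc K) 1 e
  ≡⟨ gstarCoeff-middle K e 0<e e<N ⟩
    + middleCoeff K e ∎
  where
  open ≡-Reasoning
  N : ℕ
  N = K / 2
  c : ℤ
  c = + suc (suc K)

reduceMod-Cpoly-middle : ∀ K e → 0 < e → e < K / 2 →
                         reduceMod (K / 2) (Cpoly (suc K) 1) e ≡ + middleCoeff K e
reduceMod-Cpoly-middle K e 0<e e<N =
  trans (reduceMod-coeff N (Cpoly (suc K) 1) e e<N degree≤) (coeff-Cpoly-middle K e 0<e e<N)
  where
  N : ℕ
  N = K / 2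
  degree≤ : length (Cpoly (suc K) 1) ≤ N + e
  degree≤ = ≤-trans (length-Cpoly (suc K) 1) (subst (_≤ N + e) (+-comm N 1) (+-monoʳ-≤ N 0<e))

odd⇒pred≡2*half : ∀ K → suc K % 2 ≡ 1 → K ≡ 2 * (K / 2)
odd⇒pred≡2*half K odd = trans K≡h*2 (trans (*-comm h 2) (cong (2 *_) (sym K/2≡h)))
  where
  h : ℕ
  h = suc K / 2
  K≡h*2 : K ≡ h * 2
  K≡h*2 = suc-injective (trans (m≡m%n+[m/n]*n (suc K) 2) (cong (_+ h * 2) odd))
  K/2≡h : K / 2 ≡ h
  K/2≡h = trans (cong (_/ 2) K≡h*2) (m*n/n≡m h 2)

0<m≤n/2⇒m<n : ∀ {m n} → 0 < m → m ≤ n / 2 → m < n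
0<m≤n/2⇒m<n {m} {n} 0<m m≤n/2 = begin-strict
    m             <⟨ m<m+n m 0<m ⟩
    m + m         ≤⟨ +-mono-≤ m≤n/2 m≤n/2 ⟩
    n / 2 + n / 2 ≡⟨ cong (_+_ (n / 2)) (sym (*-identityˡ (n / 2))) ⟩
    2 * (n / 2)   ≡⟨ *-comm 2 (n / 2) ⟩
    n / 2 * 2     ≤⟨ m/n*n≤m n 2 ⟩
    n             ∎
  where open ≤-Reasoning

-- The hypothesis 3 < n is not needed: an index 1 ≤ i ≤ ⌊N/2⌋ exists only when N ≥ 2.
theorem5p6 : (n : ℕ) → 3 < n → n % 2 ≡ 1 →
    IsCoterm ((n ∸ 1) / 2) (reduceMod ((n ∸ 1) / 2) (Cpoly n 1))
theorem5p6 (suc K) _ odd i 0<i i≤N/2 = begin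
    reduceMod N (Cpoly (suc K) 1) i  ≡⟨ reduceMod-Cpoly-middle K i 0<i i<N ⟩
    + middleCoeff K i                ≡⟨ cong +_ (middleCoeff-symmetric K i j 2[i+j]≡K 0<i 0<j) ⟩
    + middleCoeff K j                ≡⟨ sym (reduceMod-Cpoly-middle K j 0<j j<N) ⟩
    reduceMod N (Cpoly (suc K) 1) j  ∎
  where
  open ≡-Reasoning
  N j : ℕ
  N = K / 2
  j = N ∸ i
  i<N : i < N
  i<N = 0<m≤n/2⇒m<n 0<i i≤N/2
  j<N : j < N
  j<N = ∸-monoʳ-< 0<i (<⇒≤ i<N)
  0<j : 0 < j
  0<j = m<n⇒0<n∸m i<N
  2[i+j]≡K : 2 * (i + j) ≡ K
  2[i+j]≡K = trans (cong (2 *_) (m+[n∸m]≡n (<⇒≤ i<N))) (sym (odd⇒pred≡2*half K odd))
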